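{- Let $(T_r)_{r\in\mathbb{Z}}$ be the Tribonacci sequence. Then for every non-negative integer $k$: \[ 16\sum_{j=1}^k T_{4j-3}^2 = 2T_{4k}^2 - 3T_{4k-1}^2 - 8T_{4k-2}^2 + T_{4k-5}^2 + 4 . \]
   Context: The Tribonacci sequence $(T_r)_{r\in\mathbb{Z}}$ is defined by $T_0=0$, $T_1=1$, $T_2=1$ and $T_r=T_{r-1}+T_{r-2}+T_{r-3}$ for all integers $r$ (this determines $T_r$ for negative $r$ as well). An empty sum equals $0$. -}

module Defs where

open import Data.Nat using (ℕ; zero; suc)
open import Data.Integer using (ℤ; +_; -[1+_]; _+_; _-_; _*_)

Tpos : ℕ → ℤ
Tpos 0 = + 0
Tpos 1 = + 1
Tpos 2 = + 1
Tpos (suc (suc (suc n))) = Tpos (suc (suc n)) + Tpos (suc n) + Tpos n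

-- Tribonacci at non-positive indices: Tneg n = T_{-n},
-- obtained from T_{r-3} = T_r - T_{r-1} - T_{r-2}.
Tneg : ℕ → ℤ
Tneg 0 = + 0
Tneg 1 = + 0
Tneg 2 = + 1
Tneg (suc (suc (suc n))) = Tneg n - Tneg (suc n) - Tneg (suc (suc n))

T : ℤ → ℤ
T (+ n) = Tpos n
T -[1+ n ] = Tneg (suc n)

sumFrom1 : ℕ → (ℕ → ℤ) → ℤ
sumFrom1 zero f = + 0
sumFrom1 (suc k) f = sumFrom1 k f + f (suc k)

sq : ℤ → ℤ
sq x = x * x

-- Once all twelve terms are written in three consecutive Tribonacci values, the
-- right-hand side at k + 1 minus the right-hand side at k is identically 16 T_{4k+1}²,
-- so the formula telescopes. From k = 2 on only non-negative indices occur; the cases k = 0, 1,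
-- which reach T_{-5}, are checked by computation.
module Submission where

open import Defs
open import Data.Nat as ℕ using (ℕ; zero; suc)
import Data.Nat.Properties as ℕ
open import Data.Integer using (ℤ; +_; _+_; _-_; _*_; _⊖_)
open import Data.Integer.Properties using (m-n≡m⊖n; ⊖-≥; *-distribˡ-+)
import Data.Integer.Tactic.RingSolver as ℤ-Solver
open import Relation.Binary.PropositionalEquality
open ≡-Reasoning

tribonacci-quadratic-step : ∀ (t₀ t₁ t₂ : ℤ) →
  let t₃ = t₂ + t₁ + t₀ ; t₄ = t₃ + t₂ + t₁ ; t₅ = t₄ + t₃ + t₂
      t₆ = t₅ + t₄ + t₃ ; t₇ = t₆ + t₅ + t₄ ; t₈ = t₇ + t₆ + t₅
      t₉ = t₈ + t₇ + t₆ ; t₁₀ = t₉ + t₈ + t₇ ; t₁₁ = t₁₀ + t₉ + t₈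
      t₁₂ = t₁₁ + t₁₀ + t₉ in
  + 2 * (t₈ * t₈) - + 3 * (t₇ * t₇) - + 8 * (t₆ * t₆) + t₃ * t₃ + + 4 + + 16 * (t₉ * t₉)
    ≡ + 2 * (t₁₂ * t₁₂) - + 3 * (t₁₁ * t₁₁) - + 8 * (t₁₀ * t₁₀) + t₇ * t₇ + + 4
tribonacci-quadratic-step = ℤ-Solver.solve-∀

-- The right-hand side of the theorem at k = 2 + m is rhs (4 * m).
rhs : ℕ → ℤ
rhs n = + 2 * sq (Tpos (8 ℕ.+ n)) - + 3 * sq (Tpos (7 ℕ.+ n))
  - + 8 * sq (Tpos (6 ℕ.+ n)) + sq (Tpos (3 ℕ.+ n)) + + 4

rhs-suc⁴ : ∀ n → rhs n + + 16 * sq (Tpos (9 ℕ.+ n)) ≡ rhs (4 ℕ.+ n)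
rhs-suc⁴ n = tribonacci-quadratic-step (Tpos n) (Tpos (1 ℕ.+ n)) (Tpos (2 ℕ.+ n))

T[n-c]≡Tpos : ∀ {n} c a → n ≡ c ℕ.+ a → T (+ n - + c) ≡ Tpos a
T[n-c]≡Tpos c a refl = cong T (begin
  + (c ℕ.+ a) - + c   ≡⟨ m-n≡m⊖n (c ℕ.+ a) c ⟩
  (c ℕ.+ a) ⊖ c       ≡⟨ ⊖-≥ (ℕ.m≤m+n c a) ⟩
  + (c ℕ.+ a ℕ.∸ c)   ≡⟨ cong +_ (ℕ.m+n∸m≡n c a) ⟩
  + a                 ∎)

sixteen-sum : ∀ m → + 16 * sumFrom1 (2 ℕ.+ m) (λ j → sq (T (+ 4 * + j - + 3))) ≡ rhs (4 ℕ.* m)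
sixteen-sum zero = refl
sixteen-sum (suc m) = begin
  + 16 * (S + sq (T (+ 4 * + (3 ℕ.+ m) - + 3)))
    ≡⟨ *-distribˡ-+ (+ 16) S _ ⟩
  + 16 * S + + 16 * sq (T (+ 4 * + (3 ℕ.+ m) - + 3))
    ≡⟨ cong₂ (λ s t → s + + 16 * sq t) (sixteen-sum m)
         (T[n-c]≡Tpos 3 (9 ℕ.+ 4 ℕ.* m) (ℕ.*-distribˡ-+ 4 3 m)) ⟩
  rhs (4 ℕ.* m) + + 16 * sq (Tpos (9 ℕ.+ 4 ℕ.* m))
    ≡⟨ rhs-suc⁴ (4 ℕ.* m) ⟩
  rhs (4 ℕ.+ 4 ℕ.* m)
    ≡⟨ cong rhs (ℕ.*-suc 4 m) ⟨
  rhs (4 ℕ.* suc m)  ∎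
  where S = sumFrom1 (2 ℕ.+ m) (λ j → sq (T (+ 4 * + j - + 3)))

rhs-at : ∀ {x} n → x ≡ 8 ℕ.+ n →
  + 2 * sq (T (+ x)) - + 3 * sq (T (+ x - + 1))
    - + 8 * sq (T (+ x - + 2)) + sq (T (+ x - + 5)) + + 4
    ≡ rhs n
rhs-at n refl
  rewrite T[n-c]≡Tpos 1 (7 ℕ.+ n) refl
        | T[n-c]≡Tpos 2 (6 ℕ.+ n) refl
        | T[n-c]≡Tpos 5 (3 ℕ.+ n) refl = refl

mainTheorem11 : (k : ℕ) →
    + 16 * sumFrom1 k (λ j → sq (T (+ 4 * + j - + 3)))
      ≡ + 2 * sq (T (+ 4 * + k)) - + 3 * sq (T (+ 4 * + k - + 1))
        - + 8 * sq (T (+ 4 * + k - + 2)) + sq (T (+ 4 * + k - + 5)) + + 4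
mainTheorem11 0 = refl
mainTheorem11 1 = refl
mainTheorem11 (suc (suc m)) = trans (sixteen-sum m) (sym (rhs-at (4 ℕ.* m) (ℕ.*-distribˡ-+ 4 2 m)))
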